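{- Let $k\ge1$ and let $c$ be a class of labeled $k$-vertex patterns. For every unlabeled $k$-vertex pattern $\tilde H$, $|\mathrm{Aut}(\tilde H)|$ divides $\alpha^c_{\tilde H}$. Moreover, $\sum_{\tilde H\in U(c)}\alpha^c_{\tilde H}/|\mathrm{Aut}(\tilde H)| = 2^{k'}$, where $k'=\lfloor (k-1)/3\rfloor$.
   Context: A labeled $k$-vertex pattern is a graph with a vertex ordering $(w_0,\dots,w_{k-1})$. The class $C(H)$ of a labeled pattern $H=(v_0,\dots,v_{k-1})$ consists of all labeled patterns $(w_0,\dots,w_{k-1})$ such that $v_iv_j\in E(H)$ iff $w_iw_j$ is an edge for every pair $\{i,j\}$ other than $\{0,1\},\dots,\{0,k'\}$. An unlabeled pattern $\tilde H$ embeds in class $c$ if some vertex ordering of $\tilde H$ lies in $c$; $U(c)$ is the set of unlabeled patterns embedding in $c$; $\alpha^c_{\tilde H}$ is the number of vertex orderings of $\tilde H$ lying in $c$. $\mathrm{Aut}(\tilde H)$ is the automorphism group of $\tilde H$. -}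

module Defs where

open import Data.Nat using (ℕ; zero; suc; _≤ᵇ_; _≡ᵇ_; _∸_; _/_; _+_)
open import Data.Bool using (Bool; true; false; _∧_; _∨_; not; T)
open import Data.Fin using (Fin; toℕ)
import Data.Fin as F
import Data.Bool as B
open import Data.Vec using (Vec; []; _∷_; lookup)
open import Data.List using (List; []; _∷_; [_]; map; concatMap; allFin)
open import Data.Bool.ListAction using (all)
open import Data.List.Relation.Unary.Any using (Any)
open import Relation.Nullary.Decidable using (⌊_⌋)
open import Relation.Binary.PropositionalEquality using (_≡_)

-- A labeled k-vertex pattern: a simple graph on vertex set Fin k,
-- the vertex ordering (w_0,…,w_{k-1}) being the index order of Fin k.
record LGraph (k : ℕ) : Set where
  field
    adj  : Fin k → Fin k → Bool
    sym  : ∀ i j → adj i j ≡ adj j i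
    irr  : ∀ i → adj i i ≡ false
open LGraph public

allF : {k : ℕ} → (Fin k → Bool) → Bool
allF {k} p = all p (allFin k)

eqF : {k : ℕ} → Fin k → Fin k → Bool
eqF i j = ⌊ i F.≟ j ⌋

eqB : Bool → Bool → Bool
eqB a b = ⌊ a B.≟ b ⌋

count : {A : Set} → (A → Bool) → List A → ℕ
count p []       = 0
count p (x ∷ xs) = (if p x then 1 else 0) + count p xs
  where open Data.Bool using (if_then_else_)

allVecs : (k n : ℕ) → List (Vec (Fin k) n)
allVecs k zero    = [ [] ]
allVecs k (suc n) = concatMap (λ x → map (x ∷_) (allVecs k n)) (allFin k)

injectiveᵇ : {k : ℕ} → Vec (Fin k) k → Bool
injectiveᵇ v = allF λ i → allF λ j → eqF i j ∨ not (eqF (lookup v i) (lookup v j))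

keep : {A : Set} → (A → Bool) → List A → List A
keep p []       = []
keep p (x ∷ xs) = (if p x then x ∷ keep p xs else keep p xs)
  where open Data.Bool using (if_then_else_)

-- All vertex orderings of a graph on Fin k: the ordering (σ_0,…,σ_{k-1})
-- is a vector listing every vertex exactly once (a bijection Fin k → Fin k).
orderings : (k : ℕ) → List (Vec (Fin k) k)
orderings k = keep injectiveᵇ (allVecs k k)

relabel : {k : ℕ} → LGraph k → Vec (Fin k) k → Fin k → Fin k → Bool
relabel G σ i j = adj G (lookup σ i) (lookup σ j)

sameAdj : {k : ℕ} → (Fin k → Fin k → Bool) → (Fin k → Fin k → Bool) → Bool
sameAdj a b = allF λ i → allF λ j → eqB (a i j) (b i j)

k′ : ℕ → ℕ
k′ k = (k ∸ 1) / 3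

excluded : {k : ℕ} → Fin k → Fin k → Bool
excluded {k} i j =
  ((toℕ i ≡ᵇ 0) ∧ (1 ≤ᵇ toℕ j) ∧ (toℕ j ≤ᵇ k′ k)) ∨
  ((toℕ j ≡ᵇ 0) ∧ (1 ≤ᵇ toℕ i) ∧ (toℕ i ≤ᵇ k′ k))

inClassᵇ : {k : ℕ} → LGraph k → (Fin k → Fin k → Bool) → Bool
inClassᵇ H w = allF λ i → allF λ j →
  eqF i j ∨ excluded i j ∨ eqB (adj H i j) (w i j)

α : {k : ℕ} → LGraph k → LGraph k → ℕ
α {k} H G = count (λ σ → inClassᵇ H (relabel G σ)) (orderings k)

autCount : {k : ℕ} → LGraph k → ℕ
autCount {k} G = count (λ σ → sameAdj (relabel G σ) (adj G)) (orderings k)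

Embeds : {k : ℕ} → LGraph k → LGraph k → Set
Embeds {k} H G = Any (λ σ → T (inClassᵇ H (relabel G σ))) (orderings k)

Isomorphic : {k : ℕ} → LGraph k → LGraph k → Set
Isomorphic {k} G G' = Any (λ σ → T (sameAdj (relabel G σ) (adj G'))) (orderings k)

-- total natural-number division (only used with nonzero divisor |Aut| ≥ 1)
_÷_ : ℕ → ℕ → ℕ
a ÷ zero  = 0
a ÷ suc b = a / suc b

-- A labeled pattern lies in C(H) iff it agrees with H off the k′ pairs {0,j},
-- so the members of C(H) are the patterns W_b for the bit vectors b ∈ {0,1}^k′.
-- Hence α^c_G = Σ_b #{σ : G∘σ = W_b}. The orderings σ with G∘σ = W_b are
-- either none or a coset Aut(G)∘σ₀, so α^c_G = m_G · |Aut(G)|, where m_G is the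
-- number of b with W_b ≅ G. Summing m_G over representatives of U(c) counts
-- every b exactly once, which gives 2^k′.

module Submission where

open import Defs
open import Data.Bool using (Bool; true; false; T; if_then_else_; _∨_; _∧_; not)
open import Data.Bool.ListAction using (any)
open import Data.Bool.Properties using (T-∨; T-≡; ∨-comm; ∨-identityʳ)
open import Data.Empty using (⊥-elim)
open import Data.Fin as Fin using (Fin; zero; suc; toℕ)
import Data.Fin.Properties as Finₚ
open import Data.List using (List; []; _∷_; map; length; allFin; concatMap; filterᵇ)
import Data.List.Properties as Listₚ
open import Data.List.Membership.Propositional using (_∈_; lose; find)
open import Data.List.Membership.Propositional.Properties
  using (∈-map⁺; ∈-map⁻; ∈-concat⁺′; ∈-allFin; ∈-filter⁺; ∈-filter⁻)
open import Data.List.Membership.Propositional.Properties.WithK using (unique∧set⇒bag)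
open import Data.List.Relation.Binary.BagAndSetEquality using (∼bag⇒↭)
open import Data.List.Relation.Binary.Permutation.Propositional using (_↭_)
import Data.List.Relation.Binary.Permutation.Propositional.Properties as ↭ₚ
open import Data.List.Relation.Unary.All as All using (All)
import Data.List.Relation.Unary.All.Properties as Allₚ
open import Data.List.Relation.Unary.Any as Any using (Any; here; there)
open import Data.List.Relation.Unary.Any.Properties using (any⁺; any⁻)
open import Data.List.Relation.Unary.AllPairs as AllPairs using (AllPairs; _∷_)
import Data.List.Relation.Unary.AllPairs.Properties as AllPairsₚ
open import Data.List.Relation.Unary.Unique.Propositional using (Unique)
import Data.List.Relation.Unary.Unique.Propositional.Properties as Uniqueₚ
open import Data.Nat using (ℕ; zero; suc; _+_; _*_; _∸_; _^_; _≤_; _<_; s≤s; z≤n; _≡ᵇ_; _≤ᵇ_)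
open import Data.Nat.Divisibility using (_∣_; divides)
open import Data.Nat.DivMod using (m/n≤m; m*n/n≡m)
open import Data.Nat.ListAction using (sum)
open import Data.Nat.ListAction.Properties using (sum-↭)
open import Data.Nat.Properties
  using ( +-comm; +-identityʳ; *-zeroʳ; *-identityʳ; *-distribʳ-+; ≤-trans; m≤n+m; <-irrefl
        ; ≤⇒≤ᵇ; ≤ᵇ⇒≤; +-commutativeSemigroup)
open import Algebra.Properties.CommutativeSemigroup +-commutativeSemigroup using (interchange)
open import Data.Product using (∃; _×_; _,_; proj₁; proj₂)
open import Data.Sum using (_⊎_; inj₁; inj₂)
open import Data.Vec as Vec using (Vec; []; _∷_; lookup; tabulate)
import Data.Vec.Properties as Vecₚ
open import Function using (id; _∘_; _⇔_; mk⇔; Equivalence; Inverse)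
open import Function.Definitions using (Injective)
open import Relation.Nullary using (¬_; yes; no)
open import Relation.Nullary.Decidable using (toWitness; fromWitness; T?)
open import Relation.Binary.PropositionalEquality as ≡
  using (_≡_; _≢_; _≗_; refl; trans; cong; cong₂; subst; module ≡-Reasoning)

private
  variable
    A B : Set
    k m n : ℕ

Adj : ℕ → Set
Adj k = Fin k → Fin k → Bool

infix 4 _≐_
_≐_ : Adj k → Adj k → Set
a ≐ b = ∀ i j → a i j ≡ b i j

𝟙 : Bool → ℕ
𝟙 b = if b then 1 else 0

T-injective : {a b : Bool} → (T a → T b) → (T b → T a) → a ≡ b
T-injective {false} {false} _ _ = refl
T-injective {false} {true}  _ g = ⊥-elim (g _)
T-injective {true}  {false} f _ = ⊥-elim (f _)
T-injective {true}  {true}  _ _ = refl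

allF⁺ : (p : Fin k → Bool) → T (allF p) → ∀ i → T (p i)
allF⁺ {k} p t i = All.lookup (Allₚ.all⁺ p (allFin k) t) (∈-allFin i)

allF⁻ : (p : Fin k → Bool) → (∀ i → T (p i)) → T (allF p)
allF⁻ {k} p h = Allₚ.all⁻ p {allFin k} (All.tabulate (λ {i} _ → h i))

sameAdj⁺ : (a b : Adj k) → T (sameAdj a b) → a ≐ b
sameAdj⁺ a b t i j = toWitness (allF⁺ _ (allF⁺ _ t i) j)

sameAdj⁻ : (a b : Adj k) → a ≐ b → T (sameAdj a b)
sameAdj⁻ a b a≐b = allF⁻ _ λ i → allF⁻ _ λ j → fromWitness (a≐b i j)

sameAdj-cong : (a b c d : Adj k) → (a ≐ b ⇔ c ≐ d) → sameAdj a b ≡ sameAdj c d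
sameAdj-cong a b c d a≐b⇔c≐d = T-injective
  (sameAdj⁻ c d ∘ Equivalence.to a≐b⇔c≐d ∘ sameAdj⁺ a b)
  (sameAdj⁻ a b ∘ Equivalence.from a≐b⇔c≐d ∘ sameAdj⁺ c d)

injectiveᵇ⁺ : (σ : Vec (Fin k) k) → T (injectiveᵇ σ) → Injective _≡_ _≡_ (lookup σ)
injectiveᵇ⁺ σ t {i} {j} σi≡σj with Equivalence.to (T-∨ {eqF i j}) (allF⁺ _ (allF⁺ _ t i) j)
... | inj₁ i≡j  = toWitness i≡j
... | inj₂ σi≢σj with lookup σ i Fin.≟ lookup σ j
...   | yes _     = ⊥-elim σi≢σj
...   | no σi≢σj′ = ⊥-elim (σi≢σj′ σi≡σj)

injectiveᵇ⁻ : (σ : Vec (Fin k) k) → Injective _≡_ _≡_ (lookup σ) → T (injectiveᵇ σ)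
injectiveᵇ⁻ σ σ-inj = allF⁻ _ λ i → allF⁻ _ λ j → Equivalence.from (T-∨ {eqF i j}) (equalOrDistinct i j)
  where
  equalOrDistinct : ∀ i j → T (eqF i j) ⊎ T (not (eqF (lookup σ i) (lookup σ j)))
  equalOrDistinct i j with i Fin.≟ j
  ... | yes _ = inj₁ _
  ... | no i≢j with lookup σ i Fin.≟ lookup σ j
  ...   | yes σi≡σj = ⊥-elim (i≢j (σ-inj σi≡σj))
  ...   | no _      = inj₂ _

count≡sum : (p : A → Bool) (xs : List A) → count p xs ≡ sum (map (𝟙 ∘ p) xs)
count≡sum p []       = refl
count≡sum p (x ∷ xs) = cong (𝟙 (p x) +_) (count≡sum p xs)

count-cong : {p q : A → Bool} → (∀ x → p x ≡ q x) → (xs : List A) → count p xs ≡ count q xs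
count-cong p≗q []       = refl
count-cong p≗q (x ∷ xs) = cong₂ _+_ (cong 𝟙 (p≗q x)) (count-cong p≗q xs)

count-map : (p : B → Bool) (f : A → B) (xs : List A) → count p (map f xs) ≡ count (p ∘ f) xs
count-map p f []       = refl
count-map p f (x ∷ xs) = cong (𝟙 (p (f x)) +_) (count-map p f xs)

count-↭ : (p : A → Bool) {xs ys : List A} → xs ↭ ys → count p xs ≡ count p ys
count-↭ p {xs} {ys} xs↭ys = begin
  count p xs            ≡⟨ count≡sum p xs ⟩
  sum (map (𝟙 ∘ p) xs)  ≡⟨ sum-↭ (↭ₚ.map⁺ (𝟙 ∘ p) xs↭ys) ⟩
  sum (map (𝟙 ∘ p) ys)  ≡⟨ count≡sum p ys ⟨
  count p ys            ∎
  where open ≡-Reasoning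

count-≡0 : (p : A → Bool) {xs : List A} → (∀ {x} → x ∈ xs → ¬ T (p x)) → count p xs ≡ 0
count-≡0 p {[]}     _  = refl
count-≡0 p {x ∷ xs} ¬p with p x in px≡
... | true  = ⊥-elim (¬p (here refl) (Equivalence.from T-≡ px≡))
... | false = count-≡0 p (¬p ∘ there)

count-≡1 : (p : A → Bool) {xs : List A} → AllPairs (λ x y → ¬ (T (p x) × T (p y))) xs →
  Any (T ∘ p) xs → count p xs ≡ 1
count-≡1 p {x ∷ xs} (x⊥xs ∷ _) (here px) with p x
... | true = cong suc (count-≡0 p λ y∈xs py → All.lookup x⊥xs y∈xs (px , py))
count-≡1 p {x ∷ xs} (x⊥xs ∷ xs⊥) (there pxs) with p x
... | true  = ⊥-elim (let _ , y∈xs , py = find pxs in All.lookup x⊥xs y∈xs (_ , py))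
... | false = count-≡1 p xs⊥ pxs

count-positive : (p : A → Bool) {x : A} {xs : List A} → x ∈ xs → T (p x) → 1 ≤ count p xs
count-positive p {xs = y ∷ ys} (here refl) py with p y
... | true = s≤s z≤n
count-positive p {xs = y ∷ ys} (there x∈ys) px = ≤-trans (count-positive p x∈ys px) (m≤n+m _ _)

sum-map-const : (c : ℕ) (xs : List A) → sum (map (λ _ → c) xs) ≡ length xs * c
sum-map-const c []       = refl
sum-map-const c (x ∷ xs) = cong (c +_) (sum-map-const c xs)

sum-map-+ : (f g : A → ℕ) (xs : List A) →
  sum (map (λ x → f x + g x) xs) ≡ sum (map f xs) + sum (map g xs)
sum-map-+ f g []       = refl
sum-map-+ f g (x ∷ xs) = trans (cong (f x + g x +_) (sum-map-+ f g xs))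
  (interchange (f x) (g x) (sum (map f xs)) (sum (map g xs)))

count-*ʳ : (p : A → Bool) (c : ℕ) (xs : List A) → sum (map (λ x → 𝟙 (p x) * c) xs) ≡ count p xs * c
count-*ʳ p c []       = refl
count-*ʳ p c (x ∷ xs) = trans (cong (𝟙 (p x) * c +_) (count-*ʳ p c xs))
  (≡.sym (*-distribʳ-+ c (𝟙 (p x)) (count p xs)))

sum-count-swap : (p : A → B → Bool) (xs : List A) (ys : List B) →
  sum (map (λ x → count (p x) ys) xs) ≡ sum (map (λ y → count (λ x → p x y) xs) ys)
sum-count-swap p [] ys = begin
  0                   ≡⟨ *-zeroʳ (length ys) ⟨
  length ys * 0       ≡⟨ sum-map-const 0 ys ⟨
  sum (map (λ _ → 0) ys) ∎
  where open ≡-Reasoning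
sum-count-swap p (x ∷ xs) ys = begin
  count (p x) ys + sum (map (λ x → count (p x) ys) xs)
    ≡⟨ cong₂ _+_ (count≡sum (p x) ys) (sum-count-swap p xs ys) ⟩
  sum (map (𝟙 ∘ p x) ys) + sum (map (λ y → count (λ x → p x y) xs) ys)
    ≡⟨ sum-map-+ (𝟙 ∘ p x) (λ y → count (λ x → p x y) xs) ys ⟨
  sum (map (λ y → count (λ x → p x y) (x ∷ xs)) ys) ∎
  where open ≡-Reasoning

lookup-injective : {u v : Vec A n} → lookup u ≗ lookup v → u ≡ v
lookup-injective {u = u} {v} u≗v = begin
  u                  ≡⟨ Vecₚ.tabulate∘lookup u ⟨
  tabulate (lookup u) ≡⟨ Vecₚ.tabulate-cong u≗v ⟩
  tabulate (lookup v) ≡⟨ Vecₚ.tabulate∘lookup v ⟩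
  v                  ∎
  where open ≡-Reasoning

allVecs-complete : (v : Vec (Fin k) n) → v ∈ allVecs k n
allVecs-complete         []      = here refl
allVecs-complete {k} {suc n} (x ∷ v) = ∈-concat⁺′ (∈-map⁺ (x ∷_) (allVecs-complete v))
  (∈-map⁺ (λ y → map (y ∷_) (allVecs k n)) (∈-allFin x))

allVecs-unique : (k n : ℕ) → Unique (allVecs k n)
allVecs-unique k zero    = All.[] ∷ AllPairs.[]
allVecs-unique k (suc n) = Uniqueₚ.concat⁺
  (Allₚ.map⁺ (All.tabulate (λ _ → Uniqueₚ.map⁺ Vecₚ.∷-injectiveʳ (allVecs-unique k n))))
  (AllPairsₚ.map⁺ (AllPairs.map disjoint (Uniqueₚ.allFin⁺ k)))
  where
  disjoint : {x y : Fin k} → x ≢ y → {v : Vec (Fin k) (suc n)} →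
    ¬ (v ∈ map (x ∷_) (allVecs k n) × v ∈ map (y ∷_) (allVecs k n))
  disjoint x≢y (v∈x∷ , v∈y∷) with ∈-map⁻ (_ ∷_) v∈x∷ | ∈-map⁻ (_ ∷_) v∈y∷
  ... | _ , _ , refl | _ , _ , x∷u≡y∷w = x≢y (Vecₚ.∷-injectiveˡ x∷u≡y∷w)

length-concatMap-map : {C : Set} (f : A → B → C) (ys : List B) (xs : List A) →
  length (concatMap (λ x → map (f x) ys) xs) ≡ length xs * length ys
length-concatMap-map f ys []       = refl
length-concatMap-map f ys (x ∷ xs) = trans (Listₚ.length-++ (map (f x) ys))
  (cong₂ _+_ (Listₚ.length-map (f x) ys) (length-concatMap-map f ys xs))

length-allVecs : (k n : ℕ) → length (allVecs k n) ≡ k ^ n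
length-allVecs k zero    = refl
length-allVecs k (suc n) = trans (length-concatMap-map _∷_ (allVecs k n) (allFin k))
  (cong₂ _*_ (Listₚ.length-tabulate {n = k} id) (length-allVecs k n))

keep≡filterᵇ : (p : A → Bool) (xs : List A) → keep p xs ≡ filterᵇ p xs
keep≡filterᵇ p []       = refl
keep≡filterᵇ p (x ∷ xs) with p x
... | true  = cong (x ∷_) (keep≡filterᵇ p xs)
... | false = keep≡filterᵇ p xs

∈-orderings⁺ : (σ : Vec (Fin k) k) → Injective _≡_ _≡_ (lookup σ) → σ ∈ orderings k
∈-orderings⁺ {k} σ σ-inj = subst (σ ∈_) (≡.sym (keep≡filterᵇ injectiveᵇ (allVecs k k)))
  (∈-filter⁺ (T? ∘ injectiveᵇ) (allVecs-complete σ) (injectiveᵇ⁻ σ σ-inj))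

∈-orderings⁻ : {σ : Vec (Fin k) k} → σ ∈ orderings k → Injective _≡_ _≡_ (lookup σ)
∈-orderings⁻ {k} {σ} σ∈ = injectiveᵇ⁺ σ (proj₂ (∈-filter⁻ (T? ∘ injectiveᵇ) {xs = allVecs k k}
  (subst (σ ∈_) (keep≡filterᵇ injectiveᵇ (allVecs k k)) σ∈)))

orderings-unique : (k : ℕ) → Unique (orderings k)
orderings-unique k = subst Unique (≡.sym (keep≡filterᵇ injectiveᵇ (allVecs k k)))
  (Uniqueₚ.filter⁺ (T? ∘ injectiveᵇ) (allVecs-unique k k))

infixl 7 _⊙_
_⊙_ : Vec (Fin k) k → Vec (Fin k) k → Vec (Fin k) k
σ ⊙ τ = tabulate (lookup σ ∘ lookup τ)

lookup-⊙ : (σ τ : Vec (Fin k) k) (i : Fin k) → lookup (σ ⊙ τ) i ≡ lookup σ (lookup τ i)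
lookup-⊙ σ τ = Vecₚ.lookup∘tabulate (lookup σ ∘ lookup τ)

⊙-injective : (σ τ : Vec (Fin k) k) → Injective _≡_ _≡_ (lookup σ) → Injective _≡_ _≡_ (lookup τ) →
  Injective _≡_ _≡_ (lookup (σ ⊙ τ))
⊙-injective σ τ σ-inj τ-inj {i} {j} στi≡στj =
  τ-inj (σ-inj (trans (≡.sym (lookup-⊙ σ τ i)) (trans στi≡στj (lookup-⊙ σ τ j))))

injective⇒surjective : {f : Fin n → Fin n} → Injective _≡_ _≡_ f → ∀ y → ∃ λ x → f x ≡ y
injective⇒surjective {suc n} {f} f-inj y with Finₚ.any? (λ x → f x Fin.≟ y)
... | yes hit = hit
... | no miss = ⊥-elim (<-irrefl refl (Finₚ.injective⇒≤ punchOut∘f-injective))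
  where
  -- If y is not hit, punching it out of the range injects Fin (suc n) into Fin n.
  punchOut∘f : Fin (suc n) → Fin n
  punchOut∘f x = Fin.punchOut {i = y} (λ y≡fx → miss (x , ≡.sym y≡fx))
  punchOut∘f-injective : Injective _≡_ _≡_ punchOut∘f
  punchOut∘f-injective {a} {b} eq = f-inj (Finₚ.punchOut-injective
    (λ y≡fa → miss (a , ≡.sym y≡fa)) (λ y≡fb → miss (b , ≡.sym y≡fb)) eq)

module _ (σ : Vec (Fin k) k) (σ-inj : Injective _≡_ _≡_ (lookup σ)) where

  inverse : Vec (Fin k) k
  inverse = tabulate (proj₁ ∘ injective⇒surjective σ-inj)

  lookup-inverseʳ : (y : Fin k) → lookup σ (lookup inverse y) ≡ y
  lookup-inverseʳ y rewrite Vecₚ.lookup∘tabulate (proj₁ ∘ injective⇒surjective σ-inj) y =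
    proj₂ (injective⇒surjective σ-inj y)

  lookup-inverseˡ : (x : Fin k) → lookup inverse (lookup σ x) ≡ x
  lookup-inverseˡ x = σ-inj (lookup-inverseʳ (lookup σ x))

  inverse-injective : Injective _≡_ _≡_ (lookup inverse)
  inverse-injective {a} {b} σ⁻¹a≡σ⁻¹b =
    trans (≡.sym (lookup-inverseʳ a)) (trans (cong (lookup σ) σ⁻¹a≡σ⁻¹b) (lookup-inverseʳ b))

  ⊙-⊙-inverse : (τ : Vec (Fin k) k) → τ ⊙ σ ⊙ inverse ≡ τ
  ⊙-⊙-inverse τ = lookup-injective λ i → begin
    lookup (τ ⊙ σ ⊙ inverse) i           ≡⟨ lookup-⊙ (τ ⊙ σ) inverse i ⟩
    lookup (τ ⊙ σ) (lookup inverse i)    ≡⟨ lookup-⊙ τ σ (lookup inverse i) ⟩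
    lookup τ (lookup σ (lookup inverse i)) ≡⟨ cong (lookup τ) (lookup-inverseʳ i) ⟩
    lookup τ i                           ∎
    where open ≡-Reasoning

  ⊙-inverse-⊙ : (τ : Vec (Fin k) k) → τ ⊙ inverse ⊙ σ ≡ τ
  ⊙-inverse-⊙ τ = lookup-injective λ i → begin
    lookup (τ ⊙ inverse ⊙ σ) i           ≡⟨ lookup-⊙ (τ ⊙ inverse) σ i ⟩
    lookup (τ ⊙ inverse) (lookup σ i)    ≡⟨ lookup-⊙ τ inverse (lookup σ i) ⟩
    lookup τ (lookup inverse (lookup σ i)) ≡⟨ cong (lookup τ) (lookup-inverseˡ i) ⟩
    lookup τ i                           ∎
    where open ≡-Reasoning

  map-⊙ʳ-orderings : map (_⊙ σ) (orderings k) ↭ orderings k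
  map-⊙ʳ-orderings = ∼bag⇒↭ (unique∧set⇒bag
    (Uniqueₚ.map⁺ ⊙σ-injective (orderings-unique k)) (orderings-unique k) (mk⇔ to from))
    where
    ⊙σ-injective : {τ τ′ : Vec (Fin k) k} → τ ⊙ σ ≡ τ′ ⊙ σ → τ ≡ τ′
    ⊙σ-injective {τ} {τ′} eq =
      trans (≡.sym (⊙-⊙-inverse τ)) (trans (cong (_⊙ inverse) eq) (⊙-⊙-inverse τ′))
    to : {τ : Vec (Fin k) k} → τ ∈ map (_⊙ σ) (orderings k) → τ ∈ orderings k
    to τ∈ with ∈-map⁻ (_⊙ σ) τ∈
    ... | ρ , ρ∈ , refl = ∈-orderings⁺ (ρ ⊙ σ) (⊙-injective ρ σ (∈-orderings⁻ ρ∈) σ-inj)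
    from : {τ : Vec (Fin k) k} → τ ∈ orderings k → τ ∈ map (_⊙ σ) (orderings k)
    from {τ} τ∈ = subst (_∈ map (_⊙ σ) (orderings k)) (⊙-inverse-⊙ τ)
      (∈-map⁺ (_⊙ σ) (∈-orderings⁺ (τ ⊙ inverse)
        (⊙-injective τ inverse (∈-orderings⁻ τ∈) inverse-injective)))

  count-orderings-⊙ʳ : (p : Vec (Fin k) k → Bool) →
    count p (orderings k) ≡ count (p ∘ (_⊙ σ)) (orderings k)
  count-orderings-⊙ʳ p =
    trans (≡.sym (count-↭ p map-⊙ʳ-orderings)) (count-map p (_⊙ σ) (orderings k))

isomorphismᵇ : LGraph k → Adj k → Vec (Fin k) k → Bool
isomorphismᵇ G w σ = sameAdj (relabel G σ) w

IsomorphicTo : LGraph k → Adj k → Set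
IsomorphicTo {k} G w = Any (T ∘ isomorphismᵇ G w) (orderings k)

isomorphicToᵇ : LGraph k → Adj k → Bool
isomorphicToᵇ {k} G w = any (isomorphismᵇ G w) (orderings k)

isomorphicTo⁺ : (G : LGraph k) {w : Adj k} (σ : Vec (Fin k) k) → Injective _≡_ _≡_ (lookup σ) →
  relabel G σ ≐ w → IsomorphicTo G w
isomorphicTo⁺ G {w} σ σ-inj Gσ≐w = lose (∈-orderings⁺ σ σ-inj) (sameAdj⁻ (relabel G σ) w Gσ≐w)

isomorphicTo⁻ : (G : LGraph k) {w : Adj k} → IsomorphicTo G w →
  ∃ λ σ → Injective _≡_ _≡_ (lookup σ) × relabel G σ ≐ w
isomorphicTo⁻ G {w} iso with σ , σ∈ , Gσ≈w ← find iso =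
  σ , ∈-orderings⁻ σ∈ , sameAdj⁺ (relabel G σ) w Gσ≈w

relabel-⊙ : (G : LGraph k) (σ τ : Vec (Fin k) k) (i j : Fin k) →
  relabel G (σ ⊙ τ) i j ≡ relabel G σ (lookup τ i) (lookup τ j)
relabel-⊙ G σ τ i j = cong₂ (adj G) (lookup-⊙ σ τ i) (lookup-⊙ σ τ j)

Isomorphic-sym : (G G′ : LGraph k) → Isomorphic G G′ → Isomorphic G′ G
Isomorphic-sym G G′ iso with σ , σ-inj , Gσ≐G′ ← isomorphicTo⁻ G iso =
  isomorphicTo⁺ G′ (inverse σ σ-inj) (inverse-injective σ σ-inj) λ i j →
    trans (≡.sym (Gσ≐G′ _ _)) (cong₂ (adj G) (lookup-inverseʳ σ σ-inj i) (lookup-inverseʳ σ σ-inj j))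

IsomorphicTo⇒Isomorphic : (G G′ : LGraph k) {w : Adj k} →
  IsomorphicTo G w → IsomorphicTo G′ w → Isomorphic G G′
IsomorphicTo⇒Isomorphic G G′ {w} iso iso′
  with σ , σ-inj , Gσ≐w ← isomorphicTo⁻ G iso | τ , τ-inj , G′τ≐w ← isomorphicTo⁻ G′ iso′ =
  isomorphicTo⁺ G (σ ⊙ τ⁻¹) (⊙-injective σ τ⁻¹ σ-inj (inverse-injective τ τ-inj)) λ i j →
    let i′ = lookup τ⁻¹ i ; j′ = lookup τ⁻¹ j in begin
      relabel G (σ ⊙ τ⁻¹) i j            ≡⟨ relabel-⊙ G σ τ⁻¹ i j ⟩
      relabel G σ i′ j′                  ≡⟨ Gσ≐w i′ j′ ⟩
      w i′ j′                            ≡⟨ G′τ≐w i′ j′ ⟨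
      adj G′ (lookup τ i′) (lookup τ j′)
        ≡⟨ cong₂ (adj G′) (lookup-inverseʳ τ τ-inj i) (lookup-inverseʳ τ τ-inj j) ⟩
      adj G′ i j                         ∎
    where
    open ≡-Reasoning
    τ⁻¹ = inverse τ τ-inj

⊙-isomorphism⇔automorphism : (G : LGraph k) {w : Adj k} (σ τ : Vec (Fin k) k) →
  Injective _≡_ _≡_ (lookup τ) → relabel G τ ≐ w →
  (relabel G (σ ⊙ τ) ≐ w ⇔ relabel G σ ≐ adj G)
⊙-isomorphism⇔automorphism G {w} σ τ τ-inj Gτ≐w = mk⇔ automorphism isomorphism
  where
  automorphism : relabel G (σ ⊙ τ) ≐ w → relabel G σ ≐ adj G
  automorphism Gστ≐w a b with injective⇒surjective τ-inj a | injective⇒surjective τ-inj b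
  ... | x , refl | y , refl = begin
    relabel G σ (lookup τ x) (lookup τ y) ≡⟨ relabel-⊙ G σ τ x y ⟨
    relabel G (σ ⊙ τ) x y               ≡⟨ Gστ≐w x y ⟩
    w x y                               ≡⟨ Gτ≐w x y ⟨
    adj G (lookup τ x) (lookup τ y)     ∎
    where open ≡-Reasoning
  isomorphism : relabel G σ ≐ adj G → relabel G (σ ⊙ τ) ≐ w
  isomorphism Gσ≐G x y = trans (relabel-⊙ G σ τ x y) (trans (Gσ≐G _ _) (Gτ≐w x y))

count-isomorphisms : (G : LGraph k) {w : Adj k} → IsomorphicTo G w →
  count (isomorphismᵇ G w) (orderings k) ≡ autCount G
count-isomorphisms {k} G {w} iso with τ , τ-inj , Gτ≐w ← isomorphicTo⁻ G iso = begin
  count (isomorphismᵇ G w) (orderings k)              ≡⟨ count-orderings-⊙ʳ τ τ-inj _ ⟩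
  count (isomorphismᵇ G w ∘ (_⊙ τ)) (orderings k)
    ≡⟨ count-cong (λ σ → sameAdj-cong _ _ _ _ (⊙-isomorphism⇔automorphism G σ τ τ-inj Gτ≐w))
                  (orderings k) ⟩
  autCount G                                           ∎
  where open ≡-Reasoning

count-isomorphisms-𝟙 : (G : LGraph k) (w : Adj k) →
  count (isomorphismᵇ G w) (orderings k) ≡ 𝟙 (isomorphicToᵇ G w) * autCount G
count-isomorphisms-𝟙 {k} G w with isomorphicToᵇ G w in iso≡
... | true  = trans (count-isomorphisms G (any⁻ _ (orderings k) (Equivalence.from T-≡ iso≡)))
                    (≡.sym (+-identityʳ (autCount G)))
... | false = count-≡0 (isomorphismᵇ G w) {orderings k} λ σ∈ Gσ≈w →
                subst T iso≡ (any⁺ (isomorphismᵇ G w) (lose σ∈ Gσ≈w))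

identity-injective : Injective _≡_ _≡_ (lookup (Vec.allFin k))
identity-injective {x = i} {j} eq = trans (≡.sym (Vecₚ.lookup-allFin i)) (trans eq (Vecₚ.lookup-allFin j))

autCount-positive : (G : LGraph k) → 1 ≤ autCount G
autCount-positive {k} G = count-positive _ (∈-orderings⁺ (Vec.allFin k) identity-injective)
  (sameAdj⁻ _ (adj G) λ i j → cong₂ (adj G) (Vecₚ.lookup-allFin i) (Vecₚ.lookup-allFin j))

excluded-sym : (i j : Fin k) → excluded i j ≡ excluded j i
excluded-sym {k} i j = ∨-comm (zeroWith i j) (zeroWith j i)
  where
  zeroWith : Fin k → Fin k → Bool
  zeroWith a b = (toℕ a ≡ᵇ 0) ∧ (1 ≤ᵇ toℕ b) ∧ (toℕ b ≤ᵇ k′ k)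

excluded-irrefl : (i : Fin k) → excluded i i ≡ false
excluded-irrefl zero    = refl
excluded-irrefl (suc i) = refl

inClass-agrees : (H L : LGraph k) → T (inClassᵇ H (adj L)) →
  ∀ i j → excluded i j ≡ false → adj L i j ≡ adj H i j
inClass-agrees H L L∈C i j e with Equivalence.to (T-∨ {eqF i j}) (allF⁺ _ (allF⁺ _ L∈C i) j)
... | inj₁ i≡j = subst (λ j → adj L i j ≡ adj H i j) (toWitness i≡j) (trans (irr L i) (≡.sym (irr H i)))
... | inj₂ Lij≈Hij = ≡.sym (toWitness (subst (λ e → T (e ∨ eqB (adj H i j) (adj L i j))) e Lij≈Hij))

private module Bit = Inverse Finₚ.2↔Bool

bit-injective : {x y : Fin 2} → Bit.to x ≡ Bit.to y → x ≡ y
bit-injective {x} {y} eq =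
  trans (≡.sym (Bit.strictlyInverseʳ x)) (trans (cong Bit.from eq) (Bit.strictlyInverseʳ y))

bitAt : Vec (Fin 2) m → ℕ → Bool
bitAt []       _       = false
bitAt (x ∷ xs) zero    = Bit.to x
bitAt (x ∷ xs) (suc i) = bitAt xs i

bitAt-toℕ : (b : Vec (Fin 2) m) (i : Fin m) → bitAt b (toℕ i) ≡ Bit.to (lookup b i)
bitAt-toℕ (x ∷ b) zero    = refl
bitAt-toℕ (x ∷ b) (suc i) = bitAt-toℕ b i

relabelGraph : LGraph k → Vec (Fin k) k → LGraph k
relabelGraph G σ = record { adj = relabel G σ ; sym = λ i j → sym G _ _ ; irr = λ i → irr G _ }

module PatternClass {n : ℕ} (H : LGraph (suc n)) where

  K : ℕ
  K = k′ (suc n)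

  K≤n : K ≤ n
  K≤n = m/n≤m n 3

  Bits : Set
  Bits = Vec (Fin 2) K

  allBits : List Bits
  allBits = allVecs 2 K

  embed : Fin K → Fin (suc n)
  embed m = suc (Fin.inject≤ m K≤n)

  suc≡embed : (j : Fin n) → toℕ j < K → ∃ λ m → suc j ≡ embed m
  suc≡embed j j<K = Fin.fromℕ< j<K , cong suc (Finₚ.toℕ-injective
    (trans (≡.sym (Finₚ.toℕ-fromℕ< j<K)) (≡.sym (Finₚ.toℕ-inject≤ (Fin.fromℕ< j<K) K≤n))))

  excluded-zero-embed : (m : Fin K) → T (excluded zero (embed m))
  excluded-zero-embed m = Equivalence.from T-∨
    (inj₁ (≤⇒≤ᵇ (subst (_< K) (≡.sym (Finₚ.toℕ-inject≤ m K≤n)) (Finₚ.toℕ<n m))))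

  excluded⇒ : (i j : Fin (suc n)) → T (excluded i j) →
    (i ≡ zero × ∃ λ m → j ≡ embed m) ⊎ (j ≡ zero × ∃ λ m → i ≡ embed m)
  excluded⇒ zero    (suc j) 0j∈ = inj₁ (refl , suc≡embed j (≤ᵇ⇒≤ _ _ (subst T (∨-identityʳ _) 0j∈)))
  excluded⇒ (suc i) zero    i0∈ = inj₂ (refl , suc≡embed i (≤ᵇ⇒≤ _ _ i0∈))

  -- On an excluded pair {0, j} the index below is j − 1: bit b_{j−1} decides the edge.
  classMember : Bits → Adj (suc n)
  classMember b i j = if excluded i j then bitAt b (toℕ i + toℕ j ∸ 1) else adj H i j

  classMember-sym : (b : Bits) (i j : Fin (suc n)) → classMember b i j ≡ classMember b j i
  classMember-sym b i j rewrite excluded-sym i j | +-comm (toℕ i) (toℕ j) | sym H i j = refl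

  classMember-irr : (b : Bits) (i : Fin (suc n)) → classMember b i i ≡ false
  classMember-irr b i =
    trans (cong (λ e → if e then bitAt b (toℕ i + toℕ i ∸ 1) else adj H i i) (excluded-irrefl i)) (irr H i)

  classMemberGraph : Bits → LGraph (suc n)
  classMemberGraph b = record { adj = classMember b ; sym = classMember-sym b ; irr = classMember-irr b }

  classMember-non-excluded : (b : Bits) {i j : Fin (suc n)} → excluded i j ≡ false →
    classMember b i j ≡ adj H i j
  classMember-non-excluded b {i} {j} = cong (λ e → if e then bitAt b (toℕ i + toℕ j ∸ 1) else adj H i j)

  classMember-embed : (b : Bits) (m : Fin K) → classMember b zero (embed m) ≡ Bit.to (lookup b m)
  classMember-embed b m = begin
    classMember b zero (embed m)
      ≡⟨ cong (λ e → if e then bitAt b (toℕ (Fin.inject≤ m K≤n)) else adj H zero (embed m))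
              (Equivalence.to T-≡ (excluded-zero-embed m)) ⟩
    bitAt b (toℕ (Fin.inject≤ m K≤n)) ≡⟨ cong (bitAt b) (Finₚ.toℕ-inject≤ m K≤n) ⟩
    bitAt b (toℕ m)                   ≡⟨ bitAt-toℕ b m ⟩
    Bit.to (lookup b m)               ∎
    where open ≡-Reasoning

  classMember-injective : {b b′ : Bits} → classMember b ≐ classMember b′ → b ≡ b′
  classMember-injective {b} {b′} b≐b′ = lookup-injective λ m → bit-injective (begin
    Bit.to (lookup b m)           ≡⟨ classMember-embed b m ⟨
    classMember b zero (embed m)  ≡⟨ b≐b′ zero (embed m) ⟩
    classMember b′ zero (embed m) ≡⟨ classMember-embed b′ m ⟩
    Bit.to (lookup b′ m)          ∎)
    where open ≡-Reasoning

  classMember-inClass : (b : Bits) {w : Adj (suc n)} → w ≐ classMember b → T (inClassᵇ H w)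
  classMember-inClass b {w} w≐b = allF⁻ _ λ i → allF⁻ _ λ j →
    Equivalence.from (T-∨ {eqF i j}) (inj₂ (agrees i j))
    where
    agrees : ∀ i j → T (excluded i j ∨ eqB (adj H i j) (w i j))
    agrees i j with excluded i j | w≐b i j
    ... | true  | _        = _
    ... | false | wij≡Hij  = fromWitness (≡.sym wij≡Hij)

  bitsOf : LGraph (suc n) → Bits
  bitsOf L = tabulate (λ m → Bit.from (adj L zero (embed m)))

  classMember-bitsOf : (L : LGraph (suc n)) (m : Fin K) →
    classMember (bitsOf L) zero (embed m) ≡ adj L zero (embed m)
  classMember-bitsOf L m = trans (classMember-embed (bitsOf L) m)
    (trans (cong Bit.to (Vecₚ.lookup∘tabulate _ m)) (Bit.strictlyInverseˡ _))

  inClass⇒classMember : (L : LGraph (suc n)) → T (inClassᵇ H (adj L)) → adj L ≐ classMember (bitsOf L)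
  inClass⇒classMember L L∈C i j = byExclusion (excluded i j) refl
    where
    byExclusion : (e : Bool) → excluded i j ≡ e → adj L i j ≡ classMember (bitsOf L) i j
    byExclusion false e =
      trans (inClass-agrees H L L∈C i j e) (≡.sym (classMember-non-excluded (bitsOf L) e))
    byExclusion true  e with excluded⇒ i j (Equivalence.from T-≡ e)
    ... | inj₁ (refl , m , refl) = ≡.sym (classMember-bitsOf L m)
    ... | inj₂ (refl , m , refl) =
      trans (sym L _ _) (trans (≡.sym (classMember-bitsOf L m)) (classMember-sym (bitsOf L) zero (embed m)))

  count-classMember : (L : LGraph (suc n)) →
    count (λ b → sameAdj (adj L) (classMember b)) allBits ≡ 𝟙 (inClassᵇ H (adj L))
  count-classMember L with inClassᵇ H (adj L) in L∈C
  ... | false = count-≡0 (λ b → sameAdj (adj L) (classMember b)) {allBits} λ {b} _ L≈b →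
    subst T L∈C (classMember-inClass b (sameAdj⁺ _ _ L≈b))
  ... | true  = count-≡1 (λ b → sameAdj (adj L) (classMember b)) {allBits}
    (AllPairs.map distinct (allVecs-unique 2 K))
    (lose (allVecs-complete (bitsOf L)) (sameAdj⁻ _ _ (inClass⇒classMember L (Equivalence.from T-≡ L∈C))))
    where
    distinct : {b b′ : Bits} → b ≢ b′ →
      ¬ (T (sameAdj (adj L) (classMember b)) × T (sameAdj (adj L) (classMember b′)))
    distinct b≢b′ (L≈b , L≈b′) = b≢b′ (classMember-injective λ i j →
      trans (≡.sym (sameAdj⁺ _ _ L≈b i j)) (sameAdj⁺ _ _ L≈b′ i j))

  isoMemberCount : LGraph (suc n) → ℕ
  isoMemberCount G = count (λ b → isomorphicToᵇ G (classMember b)) allBits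

  α≡isoMemberCount*autCount : (G : LGraph (suc n)) → α H G ≡ isoMemberCount G * autCount G
  α≡isoMemberCount*autCount G = begin
    α H G
      ≡⟨ count≡sum _ σs ⟩
    sum (map (λ σ → 𝟙 (inClassᵇ H (relabel G σ))) σs)
      ≡⟨ cong sum (Listₚ.map-cong (λ σ → count-classMember (relabelGraph G σ)) σs) ⟨
    sum (map (λ σ → count (λ b → isomorphismᵇ G (classMember b) σ) allBits) σs)
      ≡⟨ sum-count-swap (λ σ b → isomorphismᵇ G (classMember b) σ) σs allBits ⟩
    sum (map (λ b → count (isomorphismᵇ G (classMember b)) σs) allBits)
      ≡⟨ cong sum (Listₚ.map-cong (λ b → count-isomorphisms-𝟙 G (classMember b)) allBits) ⟩
    sum (map (λ b → 𝟙 (isomorphicToᵇ G (classMember b)) * autCount G) allBits)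
      ≡⟨ count-*ʳ (λ b → isomorphicToᵇ G (classMember b)) (autCount G) allBits ⟩
    isoMemberCount G * autCount G ∎
    where
    open ≡-Reasoning
    σs = orderings (suc n)

  α÷autCount≡isoMemberCount : (G : LGraph (suc n)) → α H G ÷ autCount G ≡ isoMemberCount G
  α÷autCount≡isoMemberCount G rewrite α≡isoMemberCount*autCount G =
    m*n÷n≡m (isoMemberCount G) (autCount-positive G)
    where
    m*n÷n≡m : ∀ m {n} → 1 ≤ n → (m * n) ÷ n ≡ m
    m*n÷n≡m m {suc n} _ = m*n/n≡m m (suc n)

  classMember-embeds : (b : Bits) → Embeds H (classMemberGraph b)
  classMember-embeds b = lose (∈-orderings⁺ (Vec.allFin (suc n)) identity-injective)
    (classMember-inClass b λ i j → cong₂ (classMember b) (Vecₚ.lookup-allFin i) (Vecₚ.lookup-allFin j))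

  sum-isoMemberCount : (Rs : List (LGraph (suc n))) →
    AllPairs (λ G G′ → ¬ Isomorphic G G′) Rs →
    ((G : LGraph (suc n)) → Embeds H G → Any (Isomorphic G) Rs) →
    sum (map isoMemberCount Rs) ≡ 2 ^ K
  sum-isoMemberCount Rs Rs-distinct Rs-cover = begin
    sum (map isoMemberCount Rs)
      ≡⟨ sum-count-swap (λ G b → isomorphicToᵇ G (classMember b)) Rs allBits ⟩
    sum (map (λ b → count (λ G → isomorphicToᵇ G (classMember b)) Rs) allBits)
      ≡⟨ cong sum (Listₚ.map-cong uniqueRepresentative allBits) ⟩
    sum (map (λ _ → 1) allBits) ≡⟨ sum-map-const 1 allBits ⟩
    length allBits * 1          ≡⟨ *-identityʳ _ ⟩
    length allBits              ≡⟨ length-allVecs 2 K ⟩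
    2 ^ K                       ∎
    where
    open ≡-Reasoning
    uniqueRepresentative : (b : Bits) → count (λ G → isomorphicToᵇ G (classMember b)) Rs ≡ 1
    uniqueRepresentative b = count-≡1 (λ G → isomorphicToᵇ G (classMember b))
      (AllPairs.map (λ {G} {G′} ¬G≅G′ (G≅b , G′≅b) →
         ¬G≅G′ (IsomorphicTo⇒Isomorphic G G′ (any⁻ _ _ G≅b) (any⁻ _ _ G′≅b))) Rs-distinct)
      (Any.map (λ {G} b≅G → any⁺ _ (Isomorphic-sym (classMemberGraph b) G b≅G))
         (Rs-cover (classMemberGraph b) (classMember-embeds b)))

theorem3p4 : (k : ℕ) → 1 ≤ k → (H : LGraph k) →
    ((G : LGraph k) → autCount G ∣ α H G) ×
    ((Rs : List (LGraph k)) →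
    All (Embeds H) Rs →
    AllPairs (λ G G′ → ¬ Isomorphic G G′) Rs →
    ((G : LGraph k) → Embeds H G → Any (Isomorphic G) Rs) →
    sum (map (λ G → α H G ÷ autCount G) Rs) ≡ 2 ^ k′ k)
theorem3p4 (suc n) _ H =
  (λ G → divides (isoMemberCount G) (α≡isoMemberCount*autCount G)) ,
  -- Representatives outside U(c) would contribute 0.
  λ Rs _ Rs-distinct Rs-cover → begin
    sum (map (λ G → α H G ÷ autCount G) Rs)
      ≡⟨ cong sum (Listₚ.map-cong α÷autCount≡isoMemberCount Rs) ⟩
    sum (map isoMemberCount Rs)
      ≡⟨ sum-isoMemberCount Rs Rs-distinct Rs-cover ⟩
    2 ^ k′ (suc n) ∎
  where
  open PatternClass H
  open ≡-Reasoning
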